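{- Let $m$ and $n$ be positive integers. Write a partition of $n$ in multiplicity form as $n=t_1+2t_2+\cdots+nt_n$, where $t_i\ge 0$ is the number of times the part $i$ occurs (and $t_i=0$ for $i>n$). Then, for each choice of sign $\epsilon\in\{+1,-1\}$, \[ \sum_{t_1+2t_2+\cdots+nt_n=n}\epsilon^{\,t_m+t_{2m}+t_{3m}+\cdots}\left(t_m+2t_{2m}+3t_{3m}+\cdots\right) =\sum_{t_1+2t_2+\cdots+nt_n=n}\epsilon^{\,\lfloor t_1/m\rfloor+\lfloor t_2/m\rfloor+\cdots+\lfloor t_n/m\rfloor}\left(\lfloor t_1/m\rfloor+2\lfloor t_2/m\rfloor+\cdots+n\lfloor t_n/m\rfloor\right), \] and \[ \sum_{t_1+2t_2+\cdots+nt_n=n}\epsilon^{\,t_m+t_{2m}+t_{3m}+\cdots}\sum_{i\ge 0}\sum_{j=1}^{m-1}(im+j)\,t_{im+j} =\sum_{t_1+2t_2+\cdots+nt_n=n}\epsilon^{\,\lfloor t_1/m\rfloor+\lfloor t_2/m\rfloor+\cdots+\lfloor t_n/m\rfloor}\left(\langle t_1\rangle_m+2\langle t_2\rangle_m+\cdots+n\langle t_n\rangle_m\right), \] where both sums range over all partitions of $n$.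
   Context: $\lfloor x\rfloor$ denotes the integer part of a real number $x$. For an integer $x$, $\langle x\rangle_m$ denotes the least non-negative integer $r$ with $x\equiv r\pmod m$. -}

module Defs where

open import Data.Nat using (ℕ; suc; _*_; _/_; _%_; NonZero)
open import Data.Nat.Divisibility using (_∣?_)
open import Data.Fin using (toℕ)
open import Data.Vec using (Vec; zipWith; tabulate; sum)
open import Data.List using (List; map; foldr)
open import Data.Integer as ℤ using (ℤ; +_; _^_)
open import Data.Bool using (if_then_else_)
open import Relation.Nullary using (does)

-- A partition of n in multiplicity form: t : Vec ℕ n, where the entry at
-- index i (a Fin n) is t_{i+1}, the multiplicity of the part i+1.

wsum : ∀ {n} → (ℕ → ℕ → ℕ) → Vec ℕ n → ℕ
wsum f t = sum (zipWith f (tabulate (λ i → suc (toℕ i))) t)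

weight : ∀ {n} → Vec ℕ n → ℕ
weight = wsum _*_

module _ (m : ℕ) .{{_ : NonZero m}} where

  multSum : ∀ {n} → Vec ℕ n → ℕ
  multSum = wsum (λ k x → if does (m ∣? k) then x else 0)

  multWeight : ∀ {n} → Vec ℕ n → ℕ
  multWeight = wsum (λ k x → if does (m ∣? k) then (k / m) * x else 0)

  floorSum : ∀ {n} → Vec ℕ n → ℕ
  floorSum = wsum (λ k x → x / m)

  floorWeight : ∀ {n} → Vec ℕ n → ℕ
  floorWeight = wsum (λ k x → k * (x / m))

  -- Σ_{i≥0} Σ_{j=1}^{m-1} (im+j) t_{im+j}  (sum over parts k not divisible by m)
  nonMultWeight : ∀ {n} → Vec ℕ n → ℕ
  nonMultWeight = wsum (λ k x → if does (m ∣? k) then 0 else k * x)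

  remWeight : ∀ {n} → Vec ℕ n → ℕ
  remWeight = wsum (λ k x → k * (x % m))

signedSum : ∀ {n} → ℤ → (Vec ℕ n → ℕ) → (Vec ℕ n → ℕ) → List (Vec ℕ n) → ℤ
signedSum ε e w L = foldr ℤ._+_ (+ 0) (map (λ t → (ε ^ e t) ℤ.* (+ w t)) L)

-- Both identities hold summand by summand along one bijection of the partitions of n, a
-- variant of Glaisher's map: t is sent to s with s_j = dⱼ + m t_{mj}, where, writing
-- j = k mᵉ with m ∤ k, dⱼ < m is the e-th base-m digit of t_k. Then ⌊s_j/m⌋ = t_{mj} gives
-- the floor sums, and Σ j dⱼ = Σ_{m∤k} k t_k gives the remainder sum, since the digits of
-- t_k, placed at the parts k mᵉ, have weight k t_k. The digits and quotients recover t.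

module Submission where

open import Defs
open import Data.Nat using (ℕ; NonZero; _≤_)
open import Data.Vec using (Vec)
open import Data.List using (List)
open import Data.List.Membership.Propositional using (_∈_)
open import Data.List.Relation.Unary.Unique.Propositional using (Unique)
open import Data.Integer using (ℤ; 1ℤ; -1ℤ)
open import Data.Product using (_×_)
open import Data.Sum using (_⊎_)
open import Relation.Binary.PropositionalEquality using (_≡_)

open import Data.Nat.Base
  using (zero; suc; pred; _+_; _*_; _/_; _%_; _<_; z≤n; s≤s; z<s; s<s; _≤′_; ≤′-refl; ≤′-step)
open import Data.Nat.Properties
open import Data.Nat.DivMod
open import Data.Nat.Divisibility
  using (_∣_; divides; _∣?_; _∣0; 1∣_; n∣m*n; m∣m*n; ∣m+n∣m⇒∣n; ∣⇒≤)
open import Data.Nat.Induction using (<-rec)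
open import Data.Nat.Solver using (module +-*-Solver)
open import Algebra.Properties.CommutativeSemigroup +-commutativeSemigroup using (interchange)
open import Data.Bool.Base using (if_then_else_)
open import Data.Fin.Base using (toℕ)
open import Data.Vec.Base using ([]; _∷_; tabulate; zipWith; sum)
open import Data.List.Base using ([]; _∷_; map; foldr; length; _++_)
open import Data.List.Properties using (map-cong-local; map-∘; length-map; length-++-sucʳ)
open import Data.List.Membership.Propositional.Properties using (∈-∃++; ∈-map⁻)
open import Data.List.Relation.Unary.All as All using ([]; _∷_)
import Data.List.Relation.Unary.All.Properties as Allₚ
open import Data.List.Relation.Unary.AllPairs using ([]; _∷_)
open import Data.List.Relation.Unary.Any using (here; there)
open import Data.List.Relation.Binary.Subset.Propositional using (_⊆_)
open import Data.List.Relation.Binary.Permutation.Propositional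
  using (_↭_; prep; ↭-refl; ↭-trans; ↭-sym; ↭⇒↭ₛ)
open import Data.List.Relation.Binary.Permutation.Propositional.Properties using (shift; ∈-resp-↭)
import Data.List.Relation.Binary.Permutation.Propositional.Properties as ↭
open import Data.Integer.Base as ℤ using (_^_)
import Data.Integer.Properties as ℤ
open import Data.Product using (_,_)
open import Function.Base using (_∘_; id)
open import Relation.Nullary using (Dec; ¬_; yes; no; does; contradiction)
open import Relation.Nullary.Decidable using (dec-true; dec-false)
open import Relation.Binary.PropositionalEquality
  using (refl; sym; trans; cong; cong₂; subst; setoid; module ≡-Reasoning)
open import Data.List.Relation.Binary.Permutation.Setoid.Properties (setoid ℤ) using (foldr-commMonoid)

open +-*-Solver using (solve; _:+_; _:*_; _:=_)

∑ : ℕ → (ℕ → ℕ) → ℕ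
∑ zero    h = 0
∑ (suc N) h = h 0 + ∑ N (h ∘ suc)

infix 8 ∑
syntax ∑ N (λ i → h) = ∑[ i < N ] h

∑-cong : ∀ N {g h : ℕ → ℕ} → (∀ {i} → i < N → g i ≡ h i) → ∑ N g ≡ ∑ N h
∑-cong zero    _   = refl
∑-cong (suc N) g≡h = cong₂ _+_ (g≡h z<s) (∑-cong N (g≡h ∘ s<s))

∑-zero : ∀ N {h : ℕ → ℕ} → (∀ {i} → i < N → h i ≡ 0) → ∑ N h ≡ 0
∑-zero zero    _   = refl
∑-zero (suc N) h≡0 = cong₂ _+_ (h≡0 z<s) (∑-zero N (h≡0 ∘ s<s))

∑-distrib-+ : ∀ N (g h : ℕ → ℕ) → ∑[ i < N ] (g i + h i) ≡ ∑ N g + ∑ N h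
∑-distrib-+ zero    g h = refl
∑-distrib-+ (suc N) g h = trans (cong (g 0 + h 0 +_) (∑-distrib-+ N (g ∘ suc) (h ∘ suc)))
  (interchange (g 0) (h 0) (∑ N (g ∘ suc)) (∑ N (h ∘ suc)))

∑-distribˡ-* : ∀ N a (h : ℕ → ℕ) → ∑[ i < N ] (a * h i) ≡ a * ∑ N h
∑-distribˡ-* zero    a h = sym (*-zeroʳ a)
∑-distribˡ-* (suc N) a h =
  trans (cong (a * h 0 +_) (∑-distribˡ-* N a (h ∘ suc))) (sym (*-distribˡ-+ a (h 0) _))

∑-snoc : ∀ N (h : ℕ → ℕ) → ∑ (suc N) h ≡ ∑ N h + h N
∑-snoc zero    h = +-identityʳ (h 0)
∑-snoc (suc N) h = trans (cong (h 0 +_) (∑-snoc N (h ∘ suc))) (sym (+-assoc (h 0) _ _))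

∑-split : ∀ M N (h : ℕ → ℕ) → ∑ (M + N) h ≡ ∑ M h + ∑[ i < N ] h (M + i)
∑-split zero    N h = refl
∑-split (suc M) N h = trans (cong (h 0 +_) (∑-split M N (h ∘ suc))) (sym (+-assoc (h 0) _ _))

∑-vanishing-tail : ∀ {N N'} (h : ℕ → ℕ) → N ≤ N' → (∀ {i} → N ≤ i → h i ≡ 0) →
                   ∑ N' h ≡ ∑ N h
∑-vanishing-tail {N} h N≤N' h≡0 = go (≤⇒≤′ N≤N')
  where
  open ≡-Reasoning
  go : ∀ {N'} → N ≤′ N' → ∑ N' h ≡ ∑ N h
  go ≤′-refl               = refl
  go (≤′-step {N'} N≤′N') = begin
    ∑ (suc N') h   ≡⟨ ∑-snoc N' h ⟩
    ∑ N' h + h N'  ≡⟨ cong₂ _+_ (go N≤′N') (h≡0 (≤′⇒≤ N≤′N')) ⟩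
    ∑ N h + 0      ≡⟨ +-identityʳ _ ⟩
    ∑ N h          ∎

∑-term-≤ : ∀ N (h : ℕ → ℕ) {i} → i < N → h i ≤ ∑ N h
∑-term-≤ (suc N) h {zero}  _         = m≤m+n (h 0) _
∑-term-≤ (suc N) h {suc i} (s<s i<N) = ≤-trans (∑-term-≤ N (h ∘ suc) i<N) (m≤n+m _ (h 0))

-- t ‼ j is the multiplicity t_j of the part j: the entry of t at the (0-based) index j - 1,
-- and 0 for j = 0 and for j > n.
infixl 9 _‼_
_‼_ : ∀ {n} → Vec ℕ n → ℕ → ℕ
[]      ‼ _           = 0
(x ∷ t) ‼ zero        = 0
(x ∷ t) ‼ suc zero    = x
(x ∷ t) ‼ suc (suc j) = t ‼ suc j

wsum-∑ : ∀ {n} (g : ℕ → ℕ → ℕ) (t : Vec ℕ n) → wsum g t ≡ ∑[ i < n ] g (suc i) (t ‼ suc i)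
wsum-∑ g = go suc
  where
  go : ∀ {n} (k : ℕ → ℕ) (t : Vec ℕ n) →
       sum (zipWith g (tabulate (k ∘ toℕ)) t) ≡ ∑[ i < n ] g (k i) (t ‼ suc i)
  go k []      = refl
  go k (x ∷ t) = cong (g (k 0) x +_) (go (k ∘ suc) t)

wsum-cong : ∀ {n} {g h : ℕ → ℕ → ℕ} (t : Vec ℕ n) → (∀ k x → g k x ≡ h k x) → wsum g t ≡ wsum h t
wsum-cong {n} {g} {h} t g≡h = begin
  wsum g t                               ≡⟨ wsum-∑ g t ⟩
  ∑[ i < n ] g (suc i) (t ‼ suc i)       ≡⟨ ∑-cong n (λ {i} _ → g≡h (suc i) (t ‼ suc i)) ⟩
  ∑[ i < n ] h (suc i) (t ‼ suc i)       ≡⟨ wsum-∑ h t ⟨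
  wsum h t                               ∎
  where open ≡-Reasoning

wsum-linear : ∀ {n} a (g h : ℕ → ℕ → ℕ) (t : Vec ℕ n) →
              a * wsum g t + wsum h t ≡ wsum (λ k x → a * g k x + h k x) t
wsum-linear {n} a g h t = begin
  a * wsum g t + wsum h t
    ≡⟨ cong₂ (λ u v → a * u + v) (wsum-∑ g t) (wsum-∑ h t) ⟩
  a * ∑[ i < n ] g (suc i) (t ‼ suc i) + ∑[ i < n ] h (suc i) (t ‼ suc i)
    ≡⟨ cong (_+ _) (∑-distribˡ-* n a _) ⟨
  ∑[ i < n ] (a * g (suc i) (t ‼ suc i)) + ∑[ i < n ] h (suc i) (t ‼ suc i)
    ≡⟨ ∑-distrib-+ n _ _ ⟨
  ∑[ i < n ] (a * g (suc i) (t ‼ suc i) + h (suc i) (t ‼ suc i))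
    ≡⟨ wsum-∑ _ t ⟨
  wsum (λ k x → a * g k x + h k x) t
    ∎
  where open ≡-Reasoning

‼-tabulate : ∀ {n} (g : ℕ → ℕ) {i} → i < n → tabulate {n = n} (g ∘ suc ∘ toℕ) ‼ suc i ≡ g (suc i)
‼-tabulate {suc n} g {zero}  _         = refl
‼-tabulate {suc n} g {suc i} (s<s i<n) = ‼-tabulate {n} (g ∘ suc) i<n

‼-beyond : ∀ {n} (t : Vec ℕ n) {j} → n < j → t ‼ j ≡ 0
‼-beyond []      _                 = refl
‼-beyond (x ∷ t) {suc (suc j)} (s<s n<j) = ‼-beyond t n<j

‼-ext : ∀ {n} {t t' : Vec ℕ n} → (∀ {i} → i < n → t ‼ suc i ≡ t' ‼ suc i) → t ≡ t'
‼-ext {t = []}    {[]}      _  = refl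
‼-ext {t = x ∷ t} {y ∷ t'} eq = cong₂ _∷_ (eq z<s) (‼-ext (eq ∘ s<s))

*‼≤weight : ∀ {n} (t : Vec ℕ n) j → j * t ‼ j ≤ weight t
*‼≤weight t zero = z≤n
*‼≤weight {n} t (suc i) with i <? n
... | yes i<n = subst (suc i * t ‼ suc i ≤_) (sym (wsum-∑ _*_ t)) (∑-term-≤ n _ i<n)
... | no  i≮n rewrite ‼-beyond t (s<s (≮⇒≥ i≮n)) | *-zeroʳ i = z≤n

partition-bound : ∀ {n} {t : Vec ℕ n} → weight t ≡ n → ∀ j → j * t ‼ j ≤ n
partition-bound {t = t} t⊢n j = subst (j * t ‼ j ≤_) t⊢n (*‼≤weight t j)

m*n≤o<m⇒n≡0 : ∀ {m n o} → m * n ≤ o → o < m → n ≡ 0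
m*n≤o<m⇒n≡0 {n = zero}  _     _   = refl
m*n≤o<m⇒n≡0 {m} {suc n} mn≤o o<m = contradiction (≤-trans (m≤m*n m (suc n)) mn≤o) (<⇒≱ o<m)

module Multiples (m : ℕ) .{{_ : NonZero m}} where

  if-∣ : ∀ {A : Set} {x} (a b : A) → m ∣ x → (if does (m ∣? x) then a else b) ≡ a
  if-∣ {x = x} a b m∣x = cong (if_then a else b) (dec-true (m ∣? x) m∣x)

  if-∤ : ∀ {A : Set} {x} (a b : A) → ¬ m ∣ x → (if does (m ∣? x) then a else b) ≡ b
  if-∤ {x = x} a b m∤x = cong (if_then a else b) (dec-false (m ∣? x) m∤x)

  m*j/m≡j : ∀ j → m * j / m ≡ j
  m*j/m≡j j = trans (/-congˡ (*-comm m j)) (m*n/n≡m j m)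

  [x%m+q*m]%m≡x%m : ∀ x q → (x % m + q * m) % m ≡ x % m
  [x%m+q*m]%m≡x%m x q = trans ([m+kn]%n≡m%n (x % m) q m) (m%n%n≡m%n x m)

  [x%m+q*m]/m≡q : ∀ x q → (x % m + q * m) / m ≡ q
  [x%m+q*m]/m≡q x q = begin
    (x % m + q * m) / m       ≡⟨ +-distrib-/-∣ʳ (x % m) (n∣m*n q) ⟩
    x % m / m + q * m / m     ≡⟨ cong₂ _+_ (m<n⇒m/n≡0 (m%n<n x m)) (m*n/n≡m q m) ⟩
    q                         ∎
    where open ≡-Reasoning

  weight≡m*multWeight+nonMultWeight : ∀ {n} (t : Vec ℕ n) → m * multWeight m t + nonMultWeight m t ≡ weight t
  weight≡m*multWeight+nonMultWeight t = trans (wsum-linear m _ _ t) (wsum-cong t split)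
    where
    split : ∀ k x → m * (if does (m ∣? k) then k / m * x else 0) + (if does (m ∣? k) then 0 else k * x) ≡ k * x
    split k x with m ∣? k
    ... | yes m∣k = trans (+-identityʳ _) (trans (sym (*-assoc m (k / m) x)) (cong (_* x) (m*[n/m]≡n m∣k)))
    ... | no  _   = cong (_+ k * x) (*-zeroʳ m)

  weight≡m*floorWeight+remWeight : ∀ {n} (t : Vec ℕ n) → m * floorWeight m t + remWeight m t ≡ weight t
  weight≡m*floorWeight+remWeight t = trans (wsum-linear m _ _ t) (wsum-cong t split)
    where
    split : ∀ k x → m * (k * (x / m)) + k * (x % m) ≡ k * x
    split k x = trans (solve 4 (λ M K Q R → M :* (K :* Q) :+ K :* R := K :* (R :+ Q :* M)) refl m k (x / m) (x % m))
      (cong (k *_) (sym (m≡m%n+[m/n]*n x m)))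

  onMultiples : (ℕ → ℕ) → ℕ → ℕ
  onMultiples H x = if does (m ∣? x) then H x else 0

  onMultiples-≡0 : ∀ H {x} → H x ≡ 0 → onMultiples H x ≡ 0
  onMultiples-≡0 H {x} Hx≡0 with m ∣? x
  ... | yes _ = Hx≡0
  ... | no  _ = refl

  ∑-block : ∀ (H : ℕ → ℕ) N → ∑[ r < m ] onMultiples H (suc (m * N + r)) ≡ H (m * suc N)
  ∑-block H N = begin
    ∑ m h                      ≡⟨ cong (λ d → ∑ d h) (suc-pred m) ⟨
    ∑ (suc (pred m)) h         ≡⟨ ∑-snoc (pred m) h ⟩
    ∑ (pred m) h + h (pred m)  ≡⟨ cong₂ _+_ (∑-zero (pred m) (if-∤ _ 0 ∘ m∤)) (if-∣ _ 0 m∣last) ⟩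
    H (suc (m * N + pred m))   ≡⟨ cong H last≡ ⟩
    H (m * suc N)              ∎
    where
    open ≡-Reasoning
    h : ℕ → ℕ
    h r = onMultiples H (suc (m * N + r))
    last≡ : suc (m * N + pred m) ≡ m * suc N
    last≡ = trans (sym (+-suc (m * N) (pred m)))
              (trans (cong (m * N +_) (suc-pred m)) (trans (+-comm (m * N) m) (sym (*-suc m N))))
    m∣last : m ∣ suc (m * N + pred m)
    m∣last = subst (m ∣_) (sym last≡) (m∣m*n (suc N))
    m∤ : ∀ {r} → r < pred m → ¬ m ∣ suc (m * N + r)
    m∤ {r} r<m-1 m∣ = <⇒≱ (subst (suc r <_) (suc-pred m) (s<s r<m-1))
      (∣⇒≤ (∣m+n∣m⇒∣n (subst (m ∣_) (sym (+-suc (m * N) r)) m∣) (m∣m*n N)))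

  ∑-onMultiples-scaled : ∀ (H : ℕ → ℕ) N →
                         ∑[ i < m * N ] onMultiples H (suc i) ≡ ∑[ j < N ] H (m * suc j)
  ∑-onMultiples-scaled H zero    = cong (λ d → ∑ d (onMultiples H ∘ suc)) (*-zeroʳ m)
  ∑-onMultiples-scaled H (suc N) = begin
    ∑ (m * suc N) h
      ≡⟨ cong (λ d → ∑ d h) (trans (*-suc m N) (+-comm m (m * N))) ⟩
    ∑ (m * N + m) h
      ≡⟨ ∑-split (m * N) m h ⟩
    ∑ (m * N) h + ∑[ r < m ] h (m * N + r)
      ≡⟨ cong₂ _+_ (∑-onMultiples-scaled H N) (∑-block H N) ⟩
    ∑[ j < N ] H (m * suc j) + H (m * suc N)
      ≡⟨ ∑-snoc N (λ j → H (m * suc j)) ⟨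
    ∑[ j < suc N ] H (m * suc j)
      ∎
    where
    open ≡-Reasoning
    h : ℕ → ℕ
    h = onMultiples H ∘ suc

  ∑-onMultiples : ∀ n (H : ℕ → ℕ) → (∀ {x} → n < x → H x ≡ 0) →
                  ∑[ i < n ] onMultiples H (suc i) ≡ ∑[ j < n ] H (m * suc j)
  ∑-onMultiples n H H≡0 = trans (sym (∑-vanishing-tail _ (m≤n*m n m) (onMultiples-≡0 H ∘ H≡0 ∘ s≤s)))
                                (∑-onMultiples-scaled H n)

module Glaisher (m : ℕ) .{{_ : NonZero m}} (1<m : 1 < m) where

  open Multiples m

  j/m<j : ∀ j .{{_ : NonZero j}} → j / m < j
  j/m<j j = m/n<m j m 1<m

  -- carry f j = ⌊f k / mᵉ⌋ for j = k mᵉ with m ∤ k, so carry f j % m is the e-th base-m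
  -- digit of f k. The fuel only has to exceed the number of divisions by m, at most j.
  carryFuel : ℕ → (ℕ → ℕ) → ℕ → ℕ
  carryFuel zero       f j       = f j
  carryFuel (suc fuel) f zero    = f zero
  carryFuel (suc fuel) f (suc j) =
    if does (m ∣? suc j) then carryFuel fuel f (suc j / m) / m else f (suc j)

  carryFuel-enough : ∀ a b {f} j → j ≤ a → j ≤ b → carryFuel a f j ≡ carryFuel b f j
  carryFuel-enough zero    zero    j       _         _         = refl
  carryFuel-enough zero    (suc b) zero    _         _         = refl
  carryFuel-enough (suc a) zero    zero    _         _         = refl
  carryFuel-enough (suc a) (suc b) zero    _         _         = refl
  carryFuel-enough (suc a) (suc b) {f} (suc j) (s≤s j≤a) (s≤s j≤b) =
    cong (λ c → if does (m ∣? suc j) then c / m else f (suc j))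
      (carryFuel-enough a b (suc j / m) (below j≤a) (below j≤b))
    where
    below : ∀ {c} → j ≤ c → suc j / m ≤ c
    below = ≤-trans (≤-pred (j/m<j (suc j)))

  carry : (ℕ → ℕ) → ℕ → ℕ
  carry f j = carryFuel j f j

  carry-∤ : ∀ f {j} → ¬ m ∣ j → carry f j ≡ f j
  carry-∤ f {zero}  m∤0 = contradiction (m ∣0) m∤0
  carry-∤ f {suc j} m∤j = if-∤ _ _ m∤j

  carry-∣ : ∀ f {j} .{{_ : NonZero j}} → m ∣ j → carry f j ≡ carry f (j / m) / m
  carry-∣ f {suc j} m∣j = trans (if-∣ _ _ m∣j)
    (cong (_/ m) (carryFuel-enough j (suc j / m) (suc j / m) (≤-pred (j/m<j (suc j))) ≤-refl))

  carry-* : ∀ f j .{{_ : NonZero j}} → carry f (m * j) ≡ carry f j / m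
  carry-* f j = trans (carry-∣ f (m∣m*n j)) (cong (λ i → carry f i / m) (m*j/m≡j j))
    where
    instance
      m*j≢0 : NonZero (m * j)
      m*j≢0 = m*n≢0 m j

  carry-bound : ∀ {N} f → (∀ j → j * f j ≤ N) → ∀ j → j * carry f j ≤ N
  carry-bound {N} f bound = <-rec (λ j → j * carry f j ≤ N) step
    where
    open ≤-Reasoning
    step : ∀ j → (∀ {i} → i < j → i * carry f i ≤ N) → j * carry f j ≤ N
    step zero    _   = z≤n
    step (suc j) rec = by-divisibility (m ∣? suc j)
      where
      by-divisibility : Dec (m ∣ suc j) → suc j * carry f (suc j) ≤ N
      by-divisibility (no m∤j) = subst (λ c → suc j * c ≤ N) (sym (carry-∤ f m∤j)) (bound (suc j))
      by-divisibility (yes m∣j) = begin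
        suc j * carry f (suc j)     ≡⟨ cong₂ _*_ (sym (m*[n/m]≡n m∣j)) (carry-∣ f m∣j) ⟩
        m * q * (carry f q / m)     ≡⟨ solve 3 (λ M Q C → M :* Q :* C := Q :* (C :* M)) refl m q (carry f q / m) ⟩
        q * (carry f q / m * m)     ≤⟨ *-monoʳ-≤ q (m/n*n≤m (carry f q) m) ⟩
        q * carry f q               ≤⟨ rec (j/m<j (suc j)) ⟩
        N                           ∎
        where
        q : ℕ
        q = suc j / m

  carry-vanishes : ∀ {N} f → (∀ j → j * f j ≤ N) → ∀ {j} → N < j → carry f j ≡ 0
  carry-vanishes f bound {j} = m*n≤o<m⇒n≡0 (carry-bound f bound j)

  carry-determined : ∀ {N} f g → (∀ {j} → N < j → carry f j ≡ 0) → (∀ {j} → N < j → carry g j ≡ 0) →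
                     (∀ j .{{_ : NonZero j}} → j ≤ N → carry f j % m ≡ carry g j % m) →
                     ∀ j .{{_ : NonZero j}} → carry f j ≡ carry g j
  carry-determined {N} f g f≡0 g≡0 digits j = go (suc N) j (m≤n+m (suc N) j)
    where
    open ≡-Reasoning
    -- Downward induction from N, since carry f j = carry f j % m + carry f (m j) * m.
    go : ∀ d j .{{_ : NonZero j}} → N < j + d → carry f j ≡ carry g j
    go d j N<j+d with N <? j
    ... | yes N<j = trans (f≡0 N<j) (sym (g≡0 N<j))
    go zero    j N<j+0   | no N≮j = contradiction (subst (N <_) (+-identityʳ j) N<j+0) N≮j
    go (suc d) j N<j+d+1 | no N≮j = begin
      carry f j                          ≡⟨ m≡m%n+[m/n]*n (carry f j) m ⟩
      carry f j % m + carry f j / m * m  ≡⟨ cong₂ (λ r q → r + q * m) (digits j (≮⇒≥ N≮j)) higher ⟩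
      carry g j % m + carry g j / m * m  ≡⟨ m≡m%n+[m/n]*n (carry g j) m ⟨
      carry g j                          ∎
      where
      instance
        m*j≢0 : NonZero (m * j)
        m*j≢0 = m*n≢0 m j
      N<mj+d : N < m * j + d
      N<mj+d = ≤-trans (subst (N <_) (+-suc j d) N<j+d+1) (+-monoˡ-≤ d (subst (j <_) (*-comm j m) (m<m*n j m 1<m)))
      higher : carry f j / m ≡ carry g j / m
      higher = trans (sym (carry-* f j)) (trans (go d (m * j) N<mj+d) (carry-* g j))

  glaisherMultiplicity : (ℕ → ℕ) → ℕ → ℕ
  glaisherMultiplicity f j = carry f j % m + f (m * j) * m

  glaisher : ∀ {n} → Vec ℕ n → Vec ℕ n
  glaisher t = tabulate (glaisherMultiplicity (t ‼_) ∘ suc ∘ toℕ)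

  module _ {n} (t : Vec ℕ n) {i} (i<n : i < n) where

    glaisher-/ : glaisher t ‼ suc i / m ≡ t ‼ (m * suc i)
    glaisher-/ = trans (/-congˡ (‼-tabulate (glaisherMultiplicity (t ‼_)) i<n))
                       ([x%m+q*m]/m≡q _ (t ‼ (m * suc i)))

    glaisher-% : glaisher t ‼ suc i % m ≡ carry (t ‼_) (suc i) % m
    glaisher-% = trans (%-congˡ (‼-tabulate (glaisherMultiplicity (t ‼_)) i<n))
                       ([x%m+q*m]%m≡x%m _ (t ‼ (m * suc i)))

  multSum-glaisher : ∀ {n} (t : Vec ℕ n) → multSum m t ≡ floorSum m (glaisher t)
  multSum-glaisher {n} t = begin
    multSum m t                             ≡⟨ wsum-∑ _ t ⟩
    ∑[ i < n ] onMultiples (t ‼_) (suc i)   ≡⟨ ∑-onMultiples n (t ‼_) (‼-beyond t) ⟩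
    ∑[ i < n ] t ‼ (m * suc i)              ≡⟨ ∑-cong n (glaisher-/ t) ⟨
    ∑[ i < n ] (glaisher t ‼ suc i / m)     ≡⟨ wsum-∑ _ (glaisher t) ⟨
    floorSum m (glaisher t)                 ∎
    where open ≡-Reasoning

  multWeight-glaisher : ∀ {n} (t : Vec ℕ n) → multWeight m t ≡ floorWeight m (glaisher t)
  multWeight-glaisher {n} t = begin
    multWeight m t
      ≡⟨ wsum-∑ _ t ⟩
    ∑[ i < n ] onMultiples H (suc i)
      ≡⟨ ∑-onMultiples n H H-vanishes ⟩
    ∑[ i < n ] (m * suc i / m * t ‼ (m * suc i))
      ≡⟨ ∑-cong n (λ {i} i<n → cong₂ _*_ (m*j/m≡j (suc i)) (sym (glaisher-/ t i<n))) ⟩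
    ∑[ i < n ] (suc i * (glaisher t ‼ suc i / m))
      ≡⟨ wsum-∑ _ (glaisher t) ⟨
    floorWeight m (glaisher t)
      ∎
    where
    open ≡-Reasoning
    H : ℕ → ℕ
    H x = x / m * t ‼ x
    H-vanishes : ∀ {x} → n < x → H x ≡ 0
    H-vanishes {x} n<x = trans (cong (x / m *_) (‼-beyond t n<x)) (*-zeroʳ (x / m))

  module _ {n} (t : Vec ℕ n) (t⊢n : weight t ≡ n) where

    private
      c : ℕ → ℕ
      c = carry (t ‼_)

      F : ℕ → ℕ
      F x = x * c x

      F-vanishes : ∀ {x} → n < x → F x ≡ 0
      F-vanishes {x} n<x = trans (cong (x *_) (carry-vanishes _ (partition-bound t⊢n) n<x)) (*-zeroʳ x)

      F-digit : ∀ j .{{_ : NonZero j}} → F j ≡ j * (c j % m) + F (m * j)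
      F-digit j = begin
        j * c j
          ≡⟨ cong (j *_) (m≡m%n+[m/n]*n (c j) m) ⟩
        j * (c j % m + c j / m * m)
          ≡⟨ solve 4 (λ J R Q M → J :* (R :+ Q :* M) := J :* R :+ M :* J :* Q) refl j (c j % m) (c j / m) m ⟩
        j * (c j % m) + m * j * (c j / m)
          ≡⟨ cong (λ q → j * (c j % m) + m * j * q) (carry-* _ j) ⟨
        j * (c j % m) + m * j * c (m * j)
          ∎
        where open ≡-Reasoning

      F-split : ∀ x → F x ≡ onMultiples F x + (if does (m ∣? x) then 0 else x * t ‼ x)
      F-split x with m ∣? x
      ... | yes _   = sym (+-identityʳ (F x))
      ... | no  m∤x = cong (x *_) (carry-∤ _ m∤x)

    -- Summing F-digit over 1 ≤ j ≤ n telescopes: both sides contain the sum of F over the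
    -- multiples of m, which cancels.
    nonMultWeight-glaisher : nonMultWeight m t ≡ remWeight m (glaisher t)
    nonMultWeight-glaisher = sym (+-cancelʳ-≡ X _ _ (begin
      remWeight m (glaisher t) + X
        ≡⟨ cong₂ _+_ (wsum-∑ _ (glaisher t)) (∑-onMultiples n F F-vanishes) ⟩
      ∑[ i < n ] (suc i * (glaisher t ‼ suc i % m)) + ∑[ i < n ] F (m * suc i)
        ≡⟨ cong (_+ ∑[ i < n ] F (m * suc i)) (∑-cong n (λ {i} i<n → cong (suc i *_) (glaisher-% t i<n))) ⟩
      ∑[ i < n ] (suc i * (c (suc i) % m)) + ∑[ i < n ] F (m * suc i)
        ≡⟨ ∑-distrib-+ n _ _ ⟨
      ∑[ i < n ] (suc i * (c (suc i) % m) + F (m * suc i))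
        ≡⟨ ∑-cong n (λ {i} _ → F-digit (suc i)) ⟨
      ∑[ i < n ] F (suc i)
        ≡⟨ ∑-cong n (λ {i} _ → F-split (suc i)) ⟩
      ∑[ i < n ] (onMultiples F (suc i) + (if does (m ∣? suc i) then 0 else suc i * t ‼ suc i))
        ≡⟨ ∑-distrib-+ n _ _ ⟩
      X + ∑[ i < n ] (if does (m ∣? suc i) then 0 else suc i * t ‼ suc i)
        ≡⟨ +-comm X _ ⟩
      ∑[ i < n ] (if does (m ∣? suc i) then 0 else suc i * t ‼ suc i) + X
        ≡⟨ cong (_+ X) (wsum-∑ _ t) ⟨
      nonMultWeight m t + X
        ∎))
      where
      open ≡-Reasoning
      X : ℕ
      X = ∑[ i < n ] onMultiples F (suc i)

    glaisher-weight : weight (glaisher t) ≡ n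
    glaisher-weight = begin
      weight (glaisher t)
        ≡⟨ weight≡m*floorWeight+remWeight (glaisher t) ⟨
      m * floorWeight m (glaisher t) + remWeight m (glaisher t)
        ≡⟨ cong₂ (λ a b → m * a + b) (multWeight-glaisher t) nonMultWeight-glaisher ⟨
      m * multWeight m t + nonMultWeight m t
        ≡⟨ weight≡m*multWeight+nonMultWeight t ⟩
      weight t
        ≡⟨ t⊢n ⟩
      n ∎
      where open ≡-Reasoning

  glaisher-injective : ∀ {n} {t t' : Vec ℕ n} → weight t ≡ n → weight t' ≡ n →
                       glaisher t ≡ glaisher t' → t ≡ t'
  glaisher-injective {n} {t} {t'} t⊢n t'⊢n s≡s' = ‼-ext same
    where
    open ≡-Reasoning
    same-carry : ∀ j .{{_ : NonZero j}} → carry (t ‼_) j ≡ carry (t' ‼_) j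
    same-carry = carry-determined (t ‼_) (t' ‼_)
      (carry-vanishes _ (partition-bound t⊢n)) (carry-vanishes _ (partition-bound t'⊢n)) same-digit
      where
      same-digit : ∀ j .{{_ : NonZero j}} → j ≤ n → carry (t ‼_) j % m ≡ carry (t' ‼_) j % m
      same-digit (suc i) i<n = begin
        carry (t ‼_) (suc i) % m     ≡⟨ glaisher-% t i<n ⟨
        glaisher t ‼ suc i % m       ≡⟨ cong (λ s → s ‼ suc i % m) s≡s' ⟩
        glaisher t' ‼ suc i % m      ≡⟨ glaisher-% t' i<n ⟩
        carry (t' ‼_) (suc i) % m    ∎
    same : ∀ {i} → i < n → t ‼ suc i ≡ t' ‼ suc i
    same {i} i<n with m ∣? suc i
    ... | no m∤i = trans (sym (carry-∤ _ m∤i)) (trans (same-carry (suc i)) (carry-∤ _ m∤i))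
    ... | yes (divides (suc q) i≡q*m) = begin
      t ‼ suc i                 ≡⟨ cong (t ‼_) i≡m*q ⟩
      t ‼ (m * suc q)           ≡⟨ glaisher-/ t q<n ⟨
      glaisher t ‼ suc q / m    ≡⟨ cong (λ s → s ‼ suc q / m) s≡s' ⟩
      glaisher t' ‼ suc q / m   ≡⟨ glaisher-/ t' q<n ⟩
      t' ‼ (m * suc q)          ≡⟨ cong (t' ‼_) i≡m*q ⟨
      t' ‼ suc i                ∎
      where
      i≡m*q : suc i ≡ m * suc q
      i≡m*q = trans i≡q*m (*-comm (suc q) m)
      q<n : q < n
      q<n = ≤-trans (subst (suc q ≤_) (sym i≡q*m) (m≤m*n (suc q) m)) i<n

module _ {A B : Set} {σ : A → B} where

  Unique-map⁺ : ∀ {xs} → Unique xs → (∀ {x y} → x ∈ xs → y ∈ xs → σ x ≡ σ y → x ≡ y) →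
                Unique (map σ xs)
  Unique-map⁺ []             _   = []
  Unique-map⁺ (x∉xs ∷ u) inj =
    Allₚ.map⁺ (All.tabulate (λ y∈xs → All.lookup x∉xs y∈xs ∘ inj (here refl) (there y∈xs)))
    ∷ Unique-map⁺ u (λ x∈ y∈ → inj (there x∈) (there y∈))

module _ {A : Set} where

  ⊆∧length≤⇒↭ : ∀ {xs ys : List A} → Unique xs → xs ⊆ ys → length ys ≤ length xs → xs ↭ ys
  ⊆∧length≤⇒↭ {[]}     {[]}    _           _     _   = ↭-refl
  ⊆∧length≤⇒↭ {x ∷ xs} (x∉xs ∷ u) xs⊆ys len with ∈-∃++ (xs⊆ys (here refl))
  ... | ys₁ , ys₂ , refl =
    ↭-trans (prep x (⊆∧length≤⇒↭ u xs⊆ys₁++ys₂ len')) (↭-sym (shift x ys₁ ys₂))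
    where
    xs⊆ys₁++ys₂ : xs ⊆ ys₁ ++ ys₂
    xs⊆ys₁++ys₂ z∈xs with ∈-resp-↭ (shift x ys₁ ys₂) (xs⊆ys (there z∈xs))
    ... | here z≡x  = contradiction (sym z≡x) (All.lookup x∉xs z∈xs)
    ... | there z∈  = z∈
    len' : length (ys₁ ++ ys₂) ≤ length xs
    len' = ≤-pred (subst (_≤ suc (length xs)) (length-++-sucʳ ys₁ x ys₂) len)

  map-↭ : ∀ (σ : A → A) {L} → Unique L → (∀ {x} → x ∈ L → σ x ∈ L) →
          (∀ {x y} → x ∈ L → y ∈ L → σ x ≡ σ y → x ≡ y) → map σ L ↭ L
  map-↭ σ {L} u closed inj = ⊆∧length≤⇒↭ (Unique-map⁺ u inj) image⊆L (≤-reflexive (sym (length-map σ L)))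
    where
    image⊆L : map σ L ⊆ L
    image⊆L z∈ with ∈-map⁻ σ z∈
    ... | _ , x∈L , refl = closed x∈L

foldr-+-↭ : ∀ {xs ys} → xs ↭ ys → foldr ℤ._+_ (ℤ.+ 0) xs ≡ foldr ℤ._+_ (ℤ.+ 0) ys
foldr-+-↭ xs↭ys = foldr-commMonoid ℤ.+-0-isCommutativeMonoid (↭⇒↭ₛ xs↭ys)

signedSum-reindex : ∀ {n} ε {L} (σ : Vec ℕ n → Vec ℕ n) → Unique L →
  (∀ {t} → t ∈ L → σ t ∈ L) → (∀ {t t'} → t ∈ L → t' ∈ L → σ t ≡ σ t' → t ≡ t') →
  ∀ {e} e' → (∀ {t} → t ∈ L → e t ≡ e' (σ t)) →
  ∀ {w} w' → (∀ {t} → t ∈ L → w t ≡ w' (σ t)) →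
  signedSum ε e w L ≡ signedSum ε e' w' L
signedSum-reindex ε {L} σ u closed inj {e} e' e≡ {w} w' w≡ = begin
  ∑ℤ (map term L)
    ≡⟨ cong ∑ℤ (map-cong-local (All.tabulate λ t∈L → cong₂ summand (e≡ t∈L) (w≡ t∈L))) ⟩
  ∑ℤ (map (term' ∘ σ) L)
    ≡⟨ cong ∑ℤ (map-∘ L) ⟩
  ∑ℤ (map term' (map σ L))
    ≡⟨ foldr-+-↭ (↭.map⁺ term' (map-↭ σ u closed inj)) ⟩
  ∑ℤ (map term' L)
    ∎
  where
  open ≡-Reasoning
  ∑ℤ : List ℤ → ℤ
  ∑ℤ = foldr ℤ._+_ (ℤ.+ 0)
  summand : ℕ → ℕ → ℤ
  summand a b = ε ^ a ℤ.* ℤ.+ b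
  term term' : Vec ℕ _ → ℤ
  term  t = summand (e t) (w t)
  term' t = summand (e' t) (w' t)

module _ {n} (t : Vec ℕ n) where

  open Multiples 1

  multSum-unit : multSum 1 t ≡ floorSum 1 t
  multSum-unit = wsum-cong t (λ k x → trans (if-∣ x 0 (1∣ k)) (sym (n/1≡n x)))

  multWeight-unit : multWeight 1 t ≡ floorWeight 1 t
  multWeight-unit = wsum-cong t (λ k x → trans (if-∣ _ 0 (1∣ k)) (cong₂ _*_ (n/1≡n k) (sym (n/1≡n x))))

  nonMultWeight-unit : nonMultWeight 1 t ≡ remWeight 1 t
  nonMultWeight-unit = wsum-cong t (λ k x →
    trans (if-∣ 0 _ (1∣ k)) (sym (trans (cong (k *_) (n%1≡0 x)) (*-zeroʳ k))))

theorem1p2 : (m n : ℕ) .{{_ : NonZero m}} → 1 ≤ n →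
    (ε : ℤ) → ε ≡ 1ℤ ⊎ ε ≡ -1ℤ →
    (L : List (Vec ℕ n)) → Unique L →
    (∀ t → t ∈ L → weight t ≡ n) → (∀ t → weight t ≡ n → t ∈ L) →
    (signedSum ε (multSum m) (multWeight m) L ≡ signedSum ε (floorSum m) (floorWeight m) L)
    × (signedSum ε (multSum m) (nonMultWeight m) L ≡ signedSum ε (floorSum m) (remWeight m) L)
theorem1p2 1 n _ ε _ L u _ _ =
    reindex (floorWeight 1) (λ {t} _ → multWeight-unit t)
  , reindex (remWeight 1) (λ {t} _ → nonMultWeight-unit t)
  where
  reindex : ∀ w' {w} → (∀ {t} → t ∈ L → w t ≡ w' t) →
            signedSum ε (multSum 1) w L ≡ signedSum ε (floorSum 1) w' L
  reindex w' = signedSum-reindex ε id u id (λ _ _ → id) (floorSum 1) (λ {t} _ → multSum-unit t) w'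
theorem1p2 m@(suc (suc _)) n _ ε _ L u L⊢n ⊢n∈L =
    reindex (floorWeight m) (λ {t} _ → multWeight-glaisher t)
  , reindex (remWeight m) (λ {t} t∈L → nonMultWeight-glaisher t (L⊢n t t∈L))
  where
  open Glaisher m (s<s z<s)
  closed : ∀ {t} → t ∈ L → glaisher t ∈ L
  closed {t} t∈L = ⊢n∈L _ (glaisher-weight t (L⊢n t t∈L))
  injective : ∀ {t t'} → t ∈ L → t' ∈ L → glaisher t ≡ glaisher t' → t ≡ t'
  injective t∈L t'∈L = glaisher-injective (L⊢n _ t∈L) (L⊢n _ t'∈L)
  reindex : ∀ w' {w} → (∀ {t} → t ∈ L → w t ≡ w' (glaisher t)) →
            signedSum ε (multSum m) w L ≡ signedSum ε (floorSum m) w' L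
  reindex w' = signedSum-reindex ε glaisher u closed injective (floorSum m) (λ {t} _ → multSum-glaisher t) w'
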